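{- Let $n>2$ and consider the directed circulant graph $C_n^+(1,2)$. For $0<l\le n$, the number $PO(n,l)$ of primitive periodic orbits of length $l$ is \[ PO(n,l)=\begin{cases}\frac{n}{l}\binom{l}{n-l} & \text{if } l<n,\\ 2 & \text{if } l=n \text{ and } n \text{ is odd},\\ 1 & \text{if } l=n \text{ and } n \text{ is even}.\end{cases} \]
   Context: $C_n^+(1,2)$ is the directed graph with vertex set $\{0,1,\dots,n-1\}$ (identified with $\mathbb{Z}/n\mathbb{Z}$) whose bonds are $(v,v+1 \bmod n)$ and $(v,v+2\bmod n)$ for every vertex $v$. A circuit of length $l\ge 1$ is a sequence of vertices $v_0,\dots,v_l$ with $v_l=v_0$ and each $(v_i,v_{i+1})$ a bond. A periodic orbit is an equivalence class of circuits under cyclic rotation; its length is the length of any of its circuits. A periodic orbit is primitive if it is not a shorter periodic orbit repeated several times. Convention: $\binom{a}{b}=0$ unless $a,b$ are integers with $0\le b\le a$. -}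

module Defs where

open import Data.Nat using (ℕ; zero; suc; _+_; _*_; _∸_; _<_; _%_)
open import Data.Nat.DivMod using (m%n<n)
open import Data.Nat.Divisibility using (_∣_)
open import Data.Fin using (Fin; toℕ; fromℕ<)
open import Data.Product using (Σ; _×_; ∃)
open import Data.Sum using (_⊎_)
open import Data.Vec using (Vec; lookup)
open import Relation.Binary.PropositionalEquality using (_≡_; _≢_)
open import Relation.Nullary using (¬_)

Bond : (n : ℕ) → Fin n → Fin n → Set
Bond zero () w
Bond (suc m) v w = (toℕ w ≡ (toℕ v + 1) % suc m) ⊎ (toℕ w ≡ (toℕ v + 2) % suc m)

_⊕_ : {l : ℕ} → Fin l → ℕ → Fin l
_⊕_ {suc l} i k = fromℕ< (m%n<n (toℕ i + k) (suc l))

-- A circuit v_0, ..., v_l with v_l = v_0 of length l is recorded as the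
-- function i ↦ v_i on Fin l (v_l is v_0); consecutive vertices must be bonds,
-- including the closing step (v_{l-1}, v_l = v_0).
IsCircuit : (n l : ℕ) → (Fin l → Fin n) → Set
IsCircuit n l c = (0 < l) × ((i : Fin l) → Bond n (c i) (c (i ⊕ 1)))

RotEq : (n l : ℕ) → (Fin l → Fin n) → (Fin l → Fin n) → Set
RotEq n l c d = Σ ℕ λ k → (i : Fin l) → d i ≡ c (i ⊕ k)

IsRepetition : (n l : ℕ) → (Fin l → Fin n) → Set
IsRepetition n l c =
  Σ ℕ λ q → (suc q < l) × (suc q ∣ l) ×
    Σ (Fin (suc q) → Fin n) λ d → IsCircuit n (suc q) d ×
      ((i : Fin l) → c i ≡ d (fromℕ< (m%n<n (toℕ i) (suc q))))

IsPrimitiveCircuit : (n l : ℕ) → (Fin l → Fin n) → Set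
IsPrimitiveCircuit n l c = IsCircuit n l c × ¬ IsRepetition n l c

-- "the number of primitive periodic orbits of length l is N":
-- there is a complete system of N pairwise rotation-inequivalent
-- representatives of the primitive circuits of length l.
NumPrimitiveOrbits : (n l N : ℕ) → Set
NumPrimitiveOrbits n l N =
  Σ (Vec (Fin l → Fin n) N) λ reps →
    ((j : Fin N) → IsPrimitiveCircuit n l (lookup reps j)) ×
    ((j j′ : Fin N) → j ≢ j′ → ¬ RotEq n l (lookup reps j) (lookup reps j′)) ×
    ((c : Fin l → Fin n) → IsPrimitiveCircuit n l c →
       Σ (Fin N) λ j → RotEq n l (lookup reps j) c)

{-# OPTIONS --safe #-}
-- A circuit of length l is a closed walk whose steps have length 1 or 2, so its total length d
-- satisfies l ≤ d ≤ 2l and d ≡ 0 (mod n). For l < n this forces d = n: the walk winds once around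
-- the cycle, hence is primitive and passes through its least vertex exactly once. Rotated to start
-- there, a circuit is determined by its start v₀ < (length of its last step) and by its steps,
-- n − l of which have length 2. This gives C(l − 1, n − l) orbits whose last step is 1 (v₀ = 0) and
-- 2 C(l − 1, n − l − 1) whose last step is 2 (v₀ ∈ {0, 1}), and l times their number is n C(l, n − l)
-- by Pascal's rule and absorption. For l = n all steps are 1 or all are 2; the circuit 0, 2, 4, …
-- is primitive exactly when n is odd.
module Submission where

open import Defs
open import Data.Bool using (Bool; true; false)
open import Data.Empty using (⊥; ⊥-elim)
open import Data.Fin using (Fin; zero; suc; toℕ; fromℕ<)
open import Data.List using (allFin)
open import Data.List.Extrema.Nat using (argmin; f[argmin]≤f[xs])
open import Data.List.Membership.Propositional.Properties using (∈-allFin)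
import Data.List.Relation.Unary.All as All
open import Data.Fin.Properties using (toℕ-fromℕ<; toℕ-injective; toℕ<n; +↔⊎)
open import Data.Nat
open import Data.Nat.Combinatorics using (_C_; nC1≡n; nCk+nC[k+1]≡[n+1]C[k+1])
open import Data.Nat.DivMod
open import Data.Nat.Divisibility using (divides)
open import Data.Nat.Properties
open import Data.Nat.Solver using (module +-*-Solver)
open import Data.Product using (Σ; _×_; _,_; proj₁; proj₂)
open import Data.Sum using (_⊎_; inj₁; inj₂)
open import Data.Sum.Function.Propositional using (_⊎-cong_)
open import Data.Vec using (lookup; tabulate)
open import Data.Vec.Properties using (lookup∘tabulate)
open import Function.Base using (_∘_)
open import Function.Bundles using (_↔_; mk↔ₛ′; Inverse)
open import Function.Properties.Inverse using (↔-refl; ↔-sym; ↔-trans)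
open import Relation.Binary.PropositionalEquality
open import Relation.Nullary using (¬_; yes; no)

open +-*-Solver

[m%n+k]%n≡[m+k]%n : ∀ m k n .{{_ : NonZero n}} → (m % n + k) % n ≡ (m + k) % n
[m%n+k]%n≡[m+k]%n m k n = begin
  (m % n + k) % n           ≡⟨ %-distribˡ-+ (m % n) k n ⟩
  (m % n % n + k % n) % n   ≡⟨ cong (λ x → (x + k % n) % n) (m%n%n≡m%n m n) ⟩
  (m % n + k % n) % n       ≡⟨ %-distribˡ-+ m k n ⟨
  (m + k) % n               ∎
  where open ≡-Reasoning

m*[n%o]%o≡m*n%o : ∀ m n o .{{_ : NonZero o}} → m * (n % o) % o ≡ m * n % o
m*[n%o]%o≡m*n%o m n o = begin
  m * (n % o) % o             ≡⟨ %-distribˡ-* m (n % o) o ⟩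
  m % o * (n % o % o) % o     ≡⟨ cong (λ x → m % o * x % o) (m%n%n≡m%n n o) ⟩
  m % o * (n % o) % o         ≡⟨ %-distribˡ-* m n o ⟨
  m * n % o                   ∎
  where open ≡-Reasoning

[m+d]%n≡m⇒d≡0⊎n⊎n+n : ∀ m d n .{{_ : NonZero n}} → m < n → d ≤ n + n → (m + d) % n ≡ m →
                       d ≡ 0 ⊎ d ≡ n ⊎ d ≡ n + n
[m+d]%n≡m⇒d≡0⊎n⊎n+n m d n m<n d≤2n returns = multiple ((m + d) / n) q≤2 d≡q*n
  where
  d≡q*n : d ≡ (m + d) / n * n
  d≡q*n = +-cancelˡ-≡ m d _ (trans (m≡m%n+[m/n]*n (m + d) n) (cong (_+ (m + d) / n * n) returns))
  q≤2 : (m + d) / n ≤ 2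
  q≤2 = *-cancelʳ-≤ _ 2 n (subst₂ _≤_ d≡q*n (cong (n +_) (sym (+-identityʳ n))) d≤2n)
  multiple : ∀ q → q ≤ 2 → d ≡ q * n → d ≡ 0 ⊎ d ≡ n ⊎ d ≡ n + n
  multiple 0 _ d≡0 = inj₁ d≡0
  multiple 1 _ d≡n = inj₂ (inj₁ (trans d≡n (+-identityʳ n)))
  multiple 2 _ d≡2n = inj₂ (inj₂ (trans d≡2n (cong (n +_) (+-identityʳ n))))
  multiple (suc (suc (suc q))) (s≤s (s≤s ())) _

z%n≡0⇒[y+q*z]%n≡y%n : ∀ y q z n .{{_ : NonZero n}} → z % n ≡ 0 → (y + q * z) % n ≡ y % n
z%n≡0⇒[y+q*z]%n≡y%n y q z n z%n≡0 = begin
  (y + q * z) % n             ≡⟨ cong (_% n) (+-comm y (q * z)) ⟩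
  (q * z + y) % n             ≡⟨ [m%n+k]%n≡[m+k]%n (q * z) y n ⟨
  (q * z % n + y) % n         ≡⟨ cong (λ x → (x + y) % n) qz%n≡0 ⟩
  y % n                       ∎
  where
  open ≡-Reasoning
  qz%n≡0 : q * z % n ≡ 0
  qz%n≡0 = trans (sym (m*[n%o]%o≡m*n%o q z n))
    (trans (cong (λ x → q * x % n) z%n≡0) (trans (cong (_% n) (*-zeroʳ q)) (m*n%n≡0 0 n)))

[a+d*[x%l]]%n≡[a+d*x]%n : ∀ a d x l n .{{_ : NonZero l}} .{{_ : NonZero n}} → d * l % n ≡ 0 →
                          (a + d * (x % l)) % n ≡ (a + d * x) % n
[a+d*[x%l]]%n≡[a+d*x]%n a d x l n dl%n≡0 = begin
  (a + d * (x % l)) % n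
    ≡⟨ z%n≡0⇒[y+q*z]%n≡y%n _ (x / l) (d * l) n dl%n≡0 ⟨
  (a + d * (x % l) + x / l * (d * l)) % n
    ≡⟨ cong (_% n) (solve 5 (λ a d r q l → a :+ d :* r :+ q :* (d :* l) := a :+ d :* (r :+ q :* l))
                          refl a d (x % l) (x / l) l) ⟩
  (a + d * (x % l + x / l * l)) % n
    ≡⟨ cong (λ y → (a + d * y) % n) (m≡m%n+[m/n]*n x l) ⟨
  (a + d * x) % n
    ∎
  where open ≡-Reasoning

n≤m⇒m<n+n⇒m%n≡m∸n : ∀ m n .{{_ : NonZero n}} → n ≤ m → m < n + n → m % n ≡ m ∸ n
n≤m⇒m<n+n⇒m%n≡m∸n m n n≤m m<2n =
  trans (sym (m≤n⇒[n∸m]%m≡n%m n≤m)) (m<n⇒m%n≡m (subst (m ∸ n <_) (m+n∸m≡n n n) (∸-monoˡ-< m<2n n≤m)))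

[m+1]%n≢[m+2]%n : ∀ m n .{{_ : NonZero n}} → 1 < n → (m + 1) % n ≢ (m + 2) % n
[m+1]%n≢[m+2]%n m n 1<n eq =
  excluded ([m+d]%n≡m⇒d≡0⊎n⊎n+n ((m + 1) % n) 1 n (m%n<n (m + 1) n) (≤-trans (<⇒≤ 1<n) (m≤m+n n n)) returns)
  where
  returns : ((m + 1) % n + 1) % n ≡ (m + 1) % n
  returns = trans ([m%n+k]%n≡[m+k]%n (m + 1) 1 n) (trans (cong (_% n) (+-assoc m 1 1)) (sym eq))
  excluded : 1 ≡ 0 ⊎ 1 ≡ n ⊎ 1 ≡ n + n → ⊥
  excluded (inj₁ ())
  excluded (inj₂ (inj₁ 1≡n))  = <⇒≢ 1<n 1≡n
  excluded (inj₂ (inj₂ 1≡2n)) = <⇒≢ (≤-trans 1<n (m≤m+n n n)) 1≡2n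

-- A step sequence lists the lengths of the steps of a walk: true for 2, false for 1.
Steps : Set
Steps = ℕ → Bool

twoBit : Bool → ℕ
twoBit false = 0
twoBit true  = 1

stepLength : Bool → ℕ
stepLength b = suc (twoBit b)

distance : Steps → ℕ → ℕ
distance s zero    = 0
distance s (suc t) = stepLength (s 0) + distance (s ∘ suc) t

twos : Steps → ℕ → ℕ
twos s zero    = 0
twos s (suc t) = twoBit (s 0) + twos (s ∘ suc) t

distance-snoc : ∀ s t → distance s (suc t) ≡ distance s t + stepLength (s t)
distance-snoc s zero    = +-comm (stepLength (s 0)) 0
distance-snoc s (suc t) =
  trans (cong (stepLength (s 0) +_) (distance-snoc (s ∘ suc) t)) (sym (+-assoc (stepLength (s 0)) _ _))

distance≡t+twos : ∀ s t → distance s t ≡ t + twos s t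
distance≡t+twos s zero    = refl
distance≡t+twos s (suc t) = cong suc (begin
  twoBit (s 0) + distance (s ∘ suc) t
    ≡⟨ cong (twoBit (s 0) +_) (distance≡t+twos (s ∘ suc) t) ⟩
  twoBit (s 0) + (t + twos (s ∘ suc) t)
    ≡⟨ solve 3 (λ b t w → b :+ (t :+ w) := t :+ (b :+ w)) refl (twoBit (s 0)) t _ ⟩
  t + (twoBit (s 0) + twos (s ∘ suc) t)
    ∎)
  where open ≡-Reasoning

twos≤t : ∀ s t → twos s t ≤ t
twos≤t s zero    = z≤n
twos≤t s (suc t) with s 0
... | false = m≤n⇒m≤1+n (twos≤t (s ∘ suc) t)
... | true  = s≤s (twos≤t (s ∘ suc) t)

t≤distance : ∀ s t → t ≤ distance s t
t≤distance s t = subst (t ≤_) (sym (distance≡t+twos s t)) (m≤m+n t _)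

distance≤t+t : ∀ s t → distance s t ≤ t + t
distance≤t+t s t = subst (_≤ t + t) (sym (distance≡t+twos s t)) (+-monoʳ-≤ t (twos≤t s t))

distance-strictMono : ∀ s {u t} → u < t → distance s u < distance s t
distance-strictMono s {zero}  {suc t} _         = ≤-trans (s≤s z≤n) (m≤m+n (stepLength (s 0)) _)
distance-strictMono s {suc u} {suc t} (s≤s u<t) = +-monoʳ-< (stepLength (s 0)) (distance-strictMono (s ∘ suc) u<t)

distance-mono : ∀ s {u t} → u ≤ t → distance s u ≤ distance s t
distance-mono s u≤t with m≤n⇒m<n∨m≡n u≤t
... | inj₁ u<t  = <⇒≤ (distance-strictMono s u<t)
... | inj₂ refl = ≤-refl

distance-cong : ∀ s s′ t → (∀ u → u < t → s u ≡ s′ u) → distance s t ≡ distance s′ t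
distance-cong s s′ zero    _  = refl
distance-cong s s′ (suc t) eq =
  cong₂ _+_ (cong stepLength (eq 0 (s≤s z≤n)))
            (distance-cong (s ∘ suc) (s′ ∘ suc) t (λ u u<t → eq (suc u) (s≤s u<t)))

stepLength-injective : ∀ {a b} → stepLength a ≡ stepLength b → a ≡ b
stepLength-injective {false} {false} _ = refl
stepLength-injective {true}  {true}  _ = refl

distance-injective : ∀ s s′ t → (∀ {u} → u ≤ t → distance s u ≡ distance s′ u) →
                     ∀ {u} → u < t → s u ≡ s′ u
distance-injective s s′ t same {u} u<t = stepLength-injective (+-cancelˡ-≡ (distance s u) _ _ (begin
  distance s u + stepLength (s u)    ≡⟨ distance-snoc s u ⟨
  distance s (suc u)                 ≡⟨ same u<t ⟩
  distance s′ (suc u)                ≡⟨ distance-snoc s′ u ⟩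
  distance s′ u + stepLength (s′ u)  ≡⟨ cong (_+ stepLength (s′ u)) (same (<⇒≤ u<t)) ⟨
  distance s u + stepLength (s′ u)   ∎))
  where open ≡-Reasoning

twos≡0⇒distance≡id : ∀ s t → twos s t ≡ 0 → ∀ {u} → u ≤ t → distance s u ≡ u
twos≡0⇒distance≡id s t       _     {zero}  _ = refl
twos≡0⇒distance≡id s (suc t) noTwo {suc u} (s≤s u≤t) with s 0
... | false = cong suc (twos≡0⇒distance≡id (s ∘ suc) t noTwo u≤t)

twos≡t⇒distance≡2* : ∀ s t → twos s t ≡ t → ∀ {u} → u ≤ t → distance s u ≡ 2 * u
twos≡t⇒distance≡2* s t       _      {zero}  _ = refl
twos≡t⇒distance≡2* s (suc t) allTwo {suc u} (s≤s u≤t) with s 0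
... | false = ⊥-elim (1+n≰n (subst (_≤ t) allTwo (twos≤t (s ∘ suc) t)))
... | true  = trans (cong (2 +_) (twos≡t⇒distance≡2* (s ∘ suc) t (suc-injective allTwo) u≤t)) (sym (*-suc 2 u))

data Choice : ℕ → ℕ → Set where
  []  : Choice 0 0
  one : ∀ {m j} → Choice m j → Choice (suc m) j
  two : ∀ {m j} → Choice m j → Choice (suc m) (suc j)

toSteps : ∀ {m j} → Choice m j → Steps
toSteps []      _       = false
toSteps (one P) zero    = false
toSteps (one P) (suc u) = toSteps P u
toSteps (two P) zero    = true
toSteps (two P) (suc u) = toSteps P u

twos-toSteps : ∀ {m j} (P : Choice m j) → twos (toSteps P) m ≡ j
twos-toSteps []      = refl
twos-toSteps (one P) = twos-toSteps P
twos-toSteps (two P) = cong suc (twos-toSteps P)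

distance-toSteps : ∀ {m j} (P : Choice m j) → distance (toSteps P) m ≡ m + j
distance-toSteps {m} P = trans (distance≡t+twos (toSteps P) m) (cong (m +_) (twos-toSteps P))

toSteps-subst : ∀ {m j j′} (j≡j′ : j ≡ j′) (P : Choice m j) → toSteps (subst (Choice m) j≡j′ P) ≡ toSteps P
toSteps-subst refl P = refl

toSteps-injective : ∀ {m j} (P Q : Choice m j) → (∀ u → u < m → toSteps P u ≡ toSteps Q u) → P ≡ Q
toSteps-injective []      []      _  = refl
toSteps-injective (one P) (one Q) eq = cong one (toSteps-injective P Q (λ u u<m → eq (suc u) (s≤s u<m)))
toSteps-injective (two P) (two Q) eq = cong two (toSteps-injective P Q (λ u u<m → eq (suc u) (s≤s u<m)))
toSteps-injective (one P) (two Q) eq with eq 0 (s≤s z≤n)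
... | ()
toSteps-injective (two P) (one Q) eq with eq 0 (s≤s z≤n)
... | ()

choiceOf : ∀ m (s : Steps) → Choice m (twos s m)
choiceOf zero    s = []
choiceOf (suc m) s with s 0
... | false = one (choiceOf m (s ∘ suc))
... | true  = two (choiceOf m (s ∘ suc))

toSteps-choiceOf : ∀ m s {u} → u < m → toSteps (choiceOf m s) u ≡ s u
toSteps-choiceOf (suc m) s {u} u<m with s 0 in s0
toSteps-choiceOf (suc m) s {zero}  _         | false = sym s0
toSteps-choiceOf (suc m) s {zero}  _         | true  = sym s0
toSteps-choiceOf (suc m) s {suc u} (s≤s u<m) | false = toSteps-choiceOf m (s ∘ suc) u<m
toSteps-choiceOf (suc m) s {suc u} (s≤s u<m) | true  = toSteps-choiceOf m (s ∘ suc) u<m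

Choice-split : ∀ m j → Choice (suc m) (suc j) ↔ (Choice m j ⊎ Choice m (suc j))
Choice-split m j = mk↔ₛ′ split join split-join join-split
  where
  split : Choice (suc m) (suc j) → Choice m j ⊎ Choice m (suc j)
  split (two P) = inj₁ P
  split (one P) = inj₂ P
  join : Choice m j ⊎ Choice m (suc j) → Choice (suc m) (suc j)
  join (inj₁ P) = two P
  join (inj₂ P) = one P
  split-join : ∀ x → split (join x) ≡ x
  split-join (inj₁ P) = refl
  split-join (inj₂ P) = refl
  join-split : ∀ P → join (split P) ≡ P
  join-split (two P) = refl
  join-split (one P) = refl

Choice-zero : ∀ m → Choice (suc m) 0 ↔ Choice m 0
Choice-zero m = mk↔ₛ′ (λ { (one P) → P }) one (λ _ → refl) (λ { (one P) → refl })

Choice-empty : ∀ j → Choice 0 (suc j) ↔ Fin 0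
Choice-empty j = mk↔ₛ′ (λ ()) (λ ()) (λ ()) (λ ())

Choice-nil : Choice 0 0 ↔ Fin 1
Choice-nil = mk↔ₛ′ (λ { [] → zero }) (λ { zero → [] }) (λ { zero → refl }) (λ { [] → refl })

≡⇒Fin↔ : ∀ {a b} → a ≡ b → Fin a ↔ Fin b
≡⇒Fin↔ refl = ↔-refl

Choice↔Fin : ∀ m j → Choice m j ↔ Fin (m C j)
Choice↔Fin zero    zero    = Choice-nil
Choice↔Fin zero    (suc j) = Choice-empty j
Choice↔Fin (suc m) zero    = ↔-trans (Choice-zero m) (Choice↔Fin m zero)
Choice↔Fin (suc m) (suc j) =
  ↔-trans (Choice-split m j) (↔-trans (Choice↔Fin m j ⊎-cong Choice↔Fin m (suc j))
    (↔-trans (↔-sym +↔⊎) (≡⇒Fin↔ (nCk+nC[k+1]≡[n+1]C[k+1] m j))))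

[1+k]*[1+m]C[1+k]≡[1+m]*mCk : ∀ m k → suc k * (suc m C suc k) ≡ suc m * (m C k)
[1+k]*[1+m]C[1+k]≡[1+m]*mCk zero    zero    = refl
[1+k]*[1+m]C[1+k]≡[1+m]*mCk zero    (suc k) = *-zeroʳ (2 + k)
[1+k]*[1+m]C[1+k]≡[1+m]*mCk (suc m) zero    =
  trans (+-identityʳ _) (trans (nC1≡n (2 + m)) (sym (*-identityʳ (2 + m))))
[1+k]*[1+m]C[1+k]≡[1+m]*mCk (suc m) (suc k) = begin
  (2 + k) * ((2 + m) C (2 + k))
    ≡⟨ cong ((2 + k) *_) (nCk+nC[k+1]≡[n+1]C[k+1] (suc m) (suc k)) ⟨
  (2 + k) * (c + y)
    ≡⟨ solve 3 (λ k c y → (con 2 :+ k) :* (c :+ y) := c :+ ((con 1 :+ k) :* c :+ (con 2 :+ k) :* y)) refl k c y ⟩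
  c + ((1 + k) * c + (2 + k) * y)
    ≡⟨ cong₂ (λ u v → c + (u + v)) ([1+k]*[1+m]C[1+k]≡[1+m]*mCk m k) ([1+k]*[1+m]C[1+k]≡[1+m]*mCk m (suc k)) ⟩
  c + ((1 + m) * (m C k) + (1 + m) * (m C suc k))
    ≡⟨ cong (c +_) (*-distribˡ-+ (1 + m) (m C k) (m C suc k)) ⟨
  c + (1 + m) * (m C k + m C suc k)
    ≡⟨ cong (λ x → c + (1 + m) * x) (nCk+nC[k+1]≡[n+1]C[k+1] m k) ⟩
  (2 + m) * c
    ∎
  where
  open ≡-Reasoning
  c = suc m C suc k
  y = suc m C (2 + k)

[mC[1+k]+2*mCk]*[1+m]≡[2+m+k]*[1+m]C[1+k] : ∀ m k →
  (m C suc k + (m C k + m C k)) * suc m ≡ (suc m + suc k) * (suc m C suc k)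
[mC[1+k]+2*mCk]*[1+m]≡[2+m+k]*[1+m]C[1+k] m k = begin
  (b + (a + a)) * suc m
    ≡⟨ solve 3 (λ m a b → (b :+ (a :+ a)) :* (con 1 :+ m) := (con 1 :+ m) :* (a :+ b) :+ (con 1 :+ m) :* a) refl m a b ⟩
  suc m * (a + b) + suc m * a
    ≡⟨ cong₂ (λ u v → suc m * u + v) pascal (sym ([1+k]*[1+m]C[1+k]≡[1+m]*mCk m k)) ⟩
  suc m * c + suc k * c
    ≡⟨ *-distribʳ-+ c (suc m) (suc k) ⟨
  (suc m + suc k) * c
    ∎
  where
  open ≡-Reasoning
  a = m C k
  b = m C suc k
  c = suc m C suc k
  pascal : a + b ≡ c
  pascal = nCk+nC[k+1]≡[n+1]C[k+1] m k

module _ {m : ℕ} where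

  toℕ-⊕ : (i : Fin (suc m)) (k : ℕ) → toℕ (i ⊕ k) ≡ (toℕ i + k) % suc m
  toℕ-⊕ i k = toℕ-fromℕ< _

  ⊕-assoc : (i : Fin (suc m)) (a b : ℕ) → (i ⊕ a) ⊕ b ≡ i ⊕ (a + b)
  ⊕-assoc i a b = toℕ-injective (begin
    toℕ ((i ⊕ a) ⊕ b)             ≡⟨ toℕ-⊕ (i ⊕ a) b ⟩
    (toℕ (i ⊕ a) + b) % suc m     ≡⟨ cong (λ x → (x + b) % suc m) (toℕ-⊕ i a) ⟩
    ((toℕ i + a) % suc m + b) % suc m ≡⟨ [m%n+k]%n≡[m+k]%n (toℕ i + a) b (suc m) ⟩
    (toℕ i + a + b) % suc m       ≡⟨ cong (_% suc m) (+-assoc (toℕ i) a b) ⟩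
    (toℕ i + (a + b)) % suc m     ≡⟨ toℕ-⊕ i (a + b) ⟨
    toℕ (i ⊕ (a + b))             ∎)
    where open ≡-Reasoning

  ⊕-comm-step : (i : Fin (suc m)) (a b : ℕ) → (i ⊕ a) ⊕ b ≡ (i ⊕ b) ⊕ a
  ⊕-comm-step i a b = trans (⊕-assoc i a b) (trans (cong (i ⊕_) (+-comm a b)) (sym (⊕-assoc i b a)))

  k%l≡0⇒i⊕k≡i : (i : Fin (suc m)) (k : ℕ) → k % suc m ≡ 0 → i ⊕ k ≡ i
  k%l≡0⇒i⊕k≡i i k k%l≡0 = toℕ-injective (begin
    toℕ (i ⊕ k)                  ≡⟨ toℕ-⊕ i k ⟩
    (toℕ i + k) % suc m          ≡⟨ cong (_% suc m) (+-comm (toℕ i) k) ⟩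
    (k + toℕ i) % suc m          ≡⟨ [m%n+k]%n≡[m+k]%n k (toℕ i) (suc m) ⟨
    (k % suc m + toℕ i) % suc m  ≡⟨ cong (λ x → (x + toℕ i) % suc m) k%l≡0 ⟩
    toℕ i % suc m                ≡⟨ m<n⇒m%n≡m (toℕ<n i) ⟩
    toℕ i                        ∎)
    where open ≡-Reasoning

  toℕ-zero⊕ : ∀ {t} → t < suc m → toℕ (zero {n = m} ⊕ t) ≡ t
  toℕ-zero⊕ {t} t<l = trans (toℕ-⊕ zero t) (m<n⇒m%n≡m t<l)

  zero⊕toℕ : (i : Fin (suc m)) → zero ⊕ toℕ i ≡ i
  zero⊕toℕ i = toℕ-injective (toℕ-zero⊕ (toℕ<n i))

  -- Shifting by k * m = k * l ∸ k undoes a shift by k.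
  ⊕-inverse : (i : Fin (suc m)) (k : ℕ) → (i ⊕ (k * m)) ⊕ k ≡ i
  ⊕-inverse i k = trans (⊕-assoc i (k * m) k)
    (k%l≡0⇒i⊕k≡i i (k * m + k)
      (trans (cong (_% suc m) (trans (+-comm (k * m) k) (sym (*-suc k m)))) (m*n%n≡0 k (suc m))))

  RotEq-sym : ∀ {n} {c d : Fin (suc m) → Fin n} → RotEq n (suc m) c d → RotEq n (suc m) d c
  RotEq-sym {c = c} (k , d≡c⊕k) =
    k * m , λ i → trans (cong c (sym (⊕-inverse i k))) (sym (d≡c⊕k (i ⊕ (k * m))))

NumPrimitiveOrbits-from : ∀ {n l N} (rep : Fin N → Fin l → Fin n) →
  (∀ j → IsPrimitiveCircuit n l (rep j)) →
  (∀ j j′ → RotEq n l (rep j) (rep j′) → j ≡ j′) →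
  (∀ c → IsPrimitiveCircuit n l c → Σ (Fin N) λ j → RotEq n l (rep j) c) →
  NumPrimitiveOrbits n l N
NumPrimitiveOrbits-from {n} {l} rep all-primitive distinct complete =
  tabulate rep ,
  (λ j → subst (IsPrimitiveCircuit n l) (sym (lookup-rep j)) (all-primitive j)) ,
  (λ j j′ j≢j′ rot → j≢j′ (distinct j j′ (subst₂ (RotEq n l) (lookup-rep j) (lookup-rep j′) rot))) ,
  λ c c-primitive → let (j , rot) = complete c c-primitive in
    j , subst (λ f → RotEq n l f c) (sym (lookup-rep j)) rot
  where
  lookup-rep : ∀ j → lookup (tabulate rep) j ≡ rep j
  lookup-rep = lookup∘tabulate rep

module Circulant (n′ : ℕ) where

  n : ℕ
  n = suc n′

  stepOf : ∀ v w → Bond n v w → Bool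
  stepOf v w (inj₁ _) = false
  stepOf v w (inj₂ _) = true

  toℕ-bond : ∀ v w (b : Bond n v w) → toℕ w ≡ (toℕ v + stepLength (stepOf v w b)) % n
  toℕ-bond v w (inj₁ e) = e
  toℕ-bond v w (inj₂ e) = e

  bond : ∀ v w b → toℕ w ≡ (toℕ v + stepLength b) % n → Bond n v w
  bond v w false e = inj₁ e
  bond v w true  e = inj₂ e

  vertex : ℕ → Fin n
  vertex x = fromℕ< (m%n<n x n)

  toℕ-vertex : ∀ x → toℕ (vertex x) ≡ x % n
  toℕ-vertex x = toℕ-fromℕ< _

  module _ {m : ℕ} where

    Canonical : (Fin (suc m) → Fin n) → Set
    Canonical c = ∀ i → toℕ (c zero) ≤ toℕ (c i)

    IsRepetition⇒returns-early : ∀ c → IsRepetition n (suc m) c →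
                                 Σ ℕ λ p → 0 < p × p < suc m × c (zero ⊕ p) ≡ c zero
    IsRepetition⇒returns-early c (q , p<l , _ , d , _ , c≡d) =
      suc q , s≤s z≤n , p<l , trans (c≡d (zero ⊕ suc q)) (trans (cong d period) (sym (c≡d zero)))
      where
      period : fromℕ< (m%n<n (toℕ (zero {n = m} ⊕ suc q)) (suc q)) ≡ fromℕ< (m%n<n 0 (suc q))
      period = toℕ-injective (trans (toℕ-fromℕ< (m%n<n (toℕ (zero {n = m} ⊕ suc q)) (suc q)))
        (trans (cong (_% suc q) (toℕ-zero⊕ p<l)) (trans (n%n≡0 (suc q)) (sym (toℕ-fromℕ< (m%n<n 0 (suc q)))))))

    rotate-to-canonical : ∀ c → IsCircuit n (suc m) c →
                          Σ ℕ λ k → IsCircuit n (suc m) (λ i → c (i ⊕ k)) × Canonical (λ i → c (i ⊕ k))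
    rotate-to-canonical c (0<l , bonds) = toℕ i₀ , (0<l , rotated-bonds) , minimal
      where
      i₀ : Fin (suc m)
      i₀ = argmin (toℕ ∘ c) zero (allFin (suc m))
      rotated-bonds : ∀ i → Bond n (c (i ⊕ toℕ i₀)) (c ((i ⊕ 1) ⊕ toℕ i₀))
      rotated-bonds i =
        subst (λ j → Bond n (c (i ⊕ toℕ i₀)) (c j)) (⊕-comm-step i (toℕ i₀) 1) (bonds (i ⊕ toℕ i₀))
      minimal : Canonical (λ i → c (i ⊕ toℕ i₀))
      minimal i = subst₂ (λ x y → toℕ (c x) ≤ toℕ (c y)) (sym (zero⊕toℕ i₀)) refl
        (All.lookup (f[argmin]≤f[xs] {f = toℕ ∘ c} zero (allFin (suc m))) (∈-allFin (i ⊕ toℕ i₀)))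

    module _ (c : Fin (suc m) → Fin n) (circ : IsCircuit n (suc m) c) where

      stepsOf : Steps
      stepsOf t = stepOf (c (zero ⊕ t)) (c ((zero ⊕ t) ⊕ 1)) (proj₂ circ (zero ⊕ t))

      start : ℕ
      start = toℕ (c zero)

      toℕ-walk : ∀ t → toℕ (c (zero ⊕ t)) ≡ (start + distance stepsOf t) % n
      toℕ-walk zero = trans (cong (toℕ ∘ c) (zero⊕toℕ zero))
        (sym (trans (cong (_% n) (+-identityʳ start)) (m<n⇒m%n≡m (toℕ<n (c zero)))))
      toℕ-walk (suc t) = begin
        toℕ (c (zero ⊕ suc t))
          ≡⟨ cong (toℕ ∘ c) (trans (cong (zero ⊕_) (+-comm 1 t)) (sym (⊕-assoc zero t 1))) ⟩
        toℕ (c ((zero ⊕ t) ⊕ 1))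
          ≡⟨ toℕ-bond (c (zero ⊕ t)) (c ((zero ⊕ t) ⊕ 1)) (proj₂ circ (zero ⊕ t)) ⟩
        (toℕ (c (zero ⊕ t)) + stepLength (stepsOf t)) % n
          ≡⟨ cong (λ x → (x + stepLength (stepsOf t)) % n) (toℕ-walk t) ⟩
        ((start + distance stepsOf t) % n + stepLength (stepsOf t)) % n
          ≡⟨ [m%n+k]%n≡[m+k]%n (start + distance stepsOf t) _ n ⟩
        (start + distance stepsOf t + stepLength (stepsOf t)) % n
          ≡⟨ cong (_% n) (+-assoc start _ _) ⟩
        (start + (distance stepsOf t + stepLength (stepsOf t))) % n
          ≡⟨ cong (λ x → (start + x) % n) (distance-snoc stepsOf t) ⟨
        (start + distance stepsOf (suc t)) % n
          ∎
        where open ≡-Reasoning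

      toℕ-circuit : ∀ i → toℕ (c i) ≡ (start + distance stepsOf (toℕ i)) % n
      toℕ-circuit i = trans (cong (toℕ ∘ c) (sym (zero⊕toℕ i))) (toℕ-walk (toℕ i))

      walk-closes : (start + distance stepsOf (suc m)) % n ≡ start
      walk-closes =
        sym (trans (cong (toℕ ∘ c) (sym (k%l≡0⇒i⊕k≡i zero (suc m) (n%n≡0 (suc m))))) (toℕ-walk (suc m)))

      winding : suc m ≤ n → distance stepsOf (suc m) ≡ n ⊎ (suc m ≡ n × twos stepsOf (suc m) ≡ suc m)
      winding l≤n = by-multiple ([m+d]%n≡m⇒d≡0⊎n⊎n+n start d n (toℕ<n (c zero)) d≤2n walk-closes)
        where
        d = distance stepsOf (suc m)
        w = twos stepsOf (suc m)
        d≤2n : d ≤ n + n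
        d≤2n = ≤-trans (distance≤t+t stepsOf (suc m)) (+-mono-≤ l≤n l≤n)
        by-multiple : d ≡ 0 ⊎ d ≡ n ⊎ d ≡ n + n → d ≡ n ⊎ (suc m ≡ n × w ≡ suc m)
        by-multiple (inj₁ d≡0)         =
          ⊥-elim (1+n≢0 (n≤0⇒n≡0 (subst (suc m ≤_) d≡0 (t≤distance stepsOf (suc m)))))
        by-multiple (inj₂ (inj₁ d≡n))  = inj₁ d≡n
        by-multiple (inj₂ (inj₂ d≡2n)) = inj₂ (l≡n , +-cancelˡ-≡ (suc m) w (suc m) l+w≡l+l)
          where
          l+w≡2n : suc m + w ≡ n + n
          l+w≡2n = trans (sym (distance≡t+twos stepsOf (suc m))) d≡2n
          n≤l : n ≤ suc m
          n≤l = ≮⇒≥ λ l<n → <⇒≱ (+-mono-< l<n l<n)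
            (subst (_≤ suc m + suc m) l+w≡2n (+-monoʳ-≤ (suc m) (twos≤t stepsOf (suc m))))
          l≡n : suc m ≡ n
          l≡n = ≤-antisym l≤n n≤l
          l+w≡l+l : suc m + w ≡ suc m + suc m
          l+w≡l+l = trans l+w≡2n (cong₂ _+_ (sym l≡n) (sym l≡n))

      module _ (once : distance stepsOf (suc m) ≡ n) where

        distance<n : ∀ {t} → t < suc m → distance stepsOf t < n
        distance<n {t} t<l = subst (distance stepsOf t <_) once (distance-strictMono stepsOf t<l)

        returns-only-at-end : ∀ {t} → 0 < t → t < suc m → c (zero ⊕ t) ≢ c zero
        returns-only-at-end {t} 0<t t<l returns = excluded
          ([m+d]%n≡m⇒d≡0⊎n⊎n+n start d n (toℕ<n (c zero)) (≤-trans (<⇒≤ d<n) (m≤m+n n n))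
            (trans (sym (toℕ-walk t)) (cong toℕ returns)))
          where
          d = distance stepsOf t
          d<n : d < n
          d<n = distance<n t<l
          excluded : d ≡ 0 ⊎ d ≡ n ⊎ d ≡ n + n → ⊥
          excluded (inj₁ d≡0)         = <⇒≢ (distance-strictMono stepsOf 0<t) (sym d≡0)
          excluded (inj₂ (inj₁ d≡n))  = <⇒≢ d<n d≡n
          excluded (inj₂ (inj₂ d≡2n)) = <⇒≢ (≤-trans d<n (m≤m+n n n)) d≡2n

        ¬IsRepetition : ¬ IsRepetition n (suc m) c
        ¬IsRepetition rep with IsRepetition⇒returns-early c rep
        ... | p , 0<p , p<l , returns = returns-only-at-end 0<p p<l returns

        returns⇒k%l≡0 : ∀ k → c (zero ⊕ k) ≡ c zero → k % suc m ≡ 0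
        returns⇒k%l≡0 k returns with toℕ (zero {n = m} ⊕ k) in eq
        ... | zero  = trans (sym (toℕ-⊕ zero k)) eq
        ... | suc t = ⊥-elim (returns-only-at-end (s≤s z≤n) (subst (_< suc m) eq (toℕ<n (zero ⊕ k)))
                        (trans (cong c (trans (cong (zero ⊕_) (sym eq)) (zero⊕toℕ (zero ⊕ k)))) returns))

        -- The rotation d = c ∘ (_⊕ k) starts at the vertex c k and passes through c 0; if both c
        -- and d start at their least vertex, c k = c 0, so k is a multiple of l.
        Canonical-rotation-unique : Canonical c → ∀ {d} → Canonical d → RotEq n (suc m) c d → ∀ i → d i ≡ c i
        Canonical-rotation-unique c-canonical {d} d-canonical (k , d≡c⊕k) i =
          trans (d≡c⊕k i) (cong c (k%l≡0⇒i⊕k≡i i k (returns⇒k%l≡0 k ck≡c0)))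
          where
          dpasses : d (zero ⊕ (k * m)) ≡ c zero
          dpasses = trans (d≡c⊕k _) (cong c (⊕-inverse zero k))
          ck≡c0 : c (zero ⊕ k) ≡ c zero
          ck≡c0 = toℕ-injective (≤-antisym
            (subst₂ _≤_ (cong toℕ (d≡c⊕k zero)) (cong toℕ dpasses) (d-canonical (zero ⊕ (k * m))))
            (c-canonical (zero ⊕ k)))

        module _ (canonical : Canonical c) where

          start+distance<n : ∀ {t} → t ≤ m → start + distance stepsOf t < n
          start+distance<n {t} t≤m with start + distance stepsOf t <? n
          ... | yes fits = fits
          ... | no overflows = ⊥-elim (<⇒≱ below (subst (start ≤_) wrapped (canonical (zero ⊕ t))))
            where
            d<n : distance stepsOf t < n
            d<n = distance<n (s≤s t≤m)
            n≤s+d : n ≤ start + distance stepsOf t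
            n≤s+d = ≮⇒≥ overflows
            wrapped : toℕ (c (zero ⊕ t)) ≡ start + distance stepsOf t ∸ n
            wrapped = trans (toℕ-walk t) (n≤m⇒m<n+n⇒m%n≡m∸n _ n n≤s+d (+-mono-< (toℕ<n (c zero)) d<n))
            below : start + distance stepsOf t ∸ n < start
            below = subst (start + distance stepsOf t ∸ n <_) (m+n∸n≡m start n)
              (∸-monoˡ-< (+-monoʳ-< start d<n) n≤s+d)

          toℕ-canonical : ∀ i → toℕ (c i) ≡ start + distance stepsOf (toℕ i)
          toℕ-canonical i = trans (toℕ-circuit i) (m<n⇒m%n≡m (start+distance<n (≤-pred (toℕ<n i))))

          start<last-step : start < stepLength (stepsOf m)
          start<last-step = +-cancelʳ-< (distance stepsOf m) start _
            (subst (start + distance stepsOf m <_)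
              (trans (sym once) (trans (distance-snoc stepsOf m) (+-comm (distance stepsOf m) _)))
              (start+distance<n ≤-refl))

    module _ (v₀ : ℕ) (s : Steps) (last : Bool)
             (closes : distance s m + stepLength last ≡ n) (fits : v₀ + distance s m < n) where

      walkFrom : Fin (suc m) → Fin n
      walkFrom i = vertex (v₀ + distance s (toℕ i))

      toℕ-walkFrom : ∀ i → toℕ (walkFrom i) ≡ v₀ + distance s (toℕ i)
      toℕ-walkFrom i = trans (toℕ-vertex (v₀ + distance s (toℕ i)))
        (m<n⇒m%n≡m (≤-<-trans (+-monoʳ-≤ v₀ (distance-mono s (≤-pred (toℕ<n i)))) fits))

      private
        next-vertex : ∀ i → Σ Bool λ b →
                      (v₀ + distance s (toℕ (i ⊕ 1))) % n ≡ (v₀ + distance s (toℕ i) + stepLength b) % n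
        next-vertex i with m≤n⇒m<n∨m≡n (≤-pred (toℕ<n i))
        ... | inj₁ i<m = s (toℕ i) , cong (_% n) (begin
          v₀ + distance s (toℕ (i ⊕ 1))                   ≡⟨ cong (λ t → v₀ + distance s t) toℕ-i⊕1 ⟩
          v₀ + distance s (suc (toℕ i))                   ≡⟨ cong (v₀ +_) (distance-snoc s (toℕ i)) ⟩
          v₀ + (distance s (toℕ i) + stepLength (s (toℕ i))) ≡⟨ +-assoc v₀ _ _ ⟨
          v₀ + distance s (toℕ i) + stepLength (s (toℕ i)) ∎)
          where
          open ≡-Reasoning
          toℕ-i⊕1 : toℕ (i ⊕ 1) ≡ suc (toℕ i)
          toℕ-i⊕1 = trans (toℕ-⊕ i 1) (trans (cong (_% suc m) (+-comm (toℕ i) 1)) (m<n⇒m%n≡m (s≤s i<m)))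
        ... | inj₂ i≡m = last , (begin
          (v₀ + distance s (toℕ (i ⊕ 1))) % n     ≡⟨ cong (λ t → (v₀ + distance s t) % n) wraps ⟩
          (v₀ + 0) % n                            ≡⟨ cong (_% n) (+-identityʳ v₀) ⟩
          v₀ % n                                  ≡⟨ [m+n]%n≡m%n v₀ n ⟨
          (v₀ + n) % n                            ≡⟨ cong (λ x → (v₀ + x) % n) (sym closes) ⟩
          (v₀ + (distance s m + stepLength last)) % n ≡⟨ cong (_% n) (+-assoc v₀ _ _) ⟨
          (v₀ + distance s m + stepLength last) % n ≡⟨ cong (λ t → (v₀ + distance s t + stepLength last) % n) i≡m ⟨
          (v₀ + distance s (toℕ i) + stepLength last) % n ∎)
          where
          open ≡-Reasoning
          wraps : toℕ (i ⊕ 1) ≡ 0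
          wraps = trans (toℕ-⊕ i 1) (trans (cong (λ t → (t + 1) % suc m) i≡m)
                    (trans (cong (_% suc m) (+-comm m 1)) (n%n≡0 (suc m))))

      walkFrom-isCircuit : IsCircuit n (suc m) walkFrom
      walkFrom-isCircuit = s≤s z≤n , bonds
        where
        bonds : ∀ i → Bond n (walkFrom i) (walkFrom (i ⊕ 1))
        bonds i with next-vertex i
        ... | b , next = bond (walkFrom i) (walkFrom (i ⊕ 1)) b
          (trans (toℕ-vertex (v₀ + distance s (toℕ (i ⊕ 1))))
            (trans next (cong (λ x → (x + stepLength b) % n) (sym (toℕ-walkFrom i)))))

      walkFrom-canonical : Canonical walkFrom
      walkFrom-canonical i = subst₂ _≤_ (sym (toℕ-walkFrom zero)) (sym (toℕ-walkFrom i)) (+-monoʳ-≤ v₀ z≤n)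


    progression : ℕ → ℕ → Fin (suc m) → Fin n
    progression a δ j = vertex (a + δ * toℕ j)

    progression-isCircuit : ∀ a b → stepLength b * suc m % n ≡ 0 → IsCircuit n (suc m) (progression a (stepLength b))
    progression-isCircuit a b winds = s≤s z≤n , λ j → bond (progression a δ j) (progression a δ (j ⊕ 1)) b (begin
      toℕ (progression a δ (j ⊕ 1))
        ≡⟨ toℕ-vertex (a + δ * toℕ (j ⊕ 1)) ⟩
      (a + δ * toℕ (j ⊕ 1)) % n
        ≡⟨ cong (λ x → (a + δ * x) % n) (toℕ-⊕ j 1) ⟩
      (a + δ * ((toℕ j + 1) % suc m)) % n
        ≡⟨ [a+d*[x%l]]%n≡[a+d*x]%n a δ (toℕ j + 1) (suc m) n winds ⟩
      (a + δ * (toℕ j + 1)) % n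
        ≡⟨ cong (_% n) (solve 3 (λ a δ j → a :+ δ :* (j :+ con 1) := a :+ δ :* j :+ δ) refl a δ (toℕ j)) ⟩
      (a + δ * toℕ j + δ) % n
        ≡⟨ [m%n+k]%n≡[m+k]%n (a + δ * toℕ j) δ n ⟨
      ((a + δ * toℕ j) % n + δ) % n
        ≡⟨ cong (λ x → (x + δ) % n) (toℕ-vertex (a + δ * toℕ j)) ⟨
      (toℕ (progression a δ j) + δ) % n
        ∎)
      where
      open ≡-Reasoning
      δ = stepLength b

module Length<n (m k : ℕ) where
  open Circulant (m + suc k)

  l<n : suc m < n
  l<n = s≤s (m<m+n m (s≤s z≤n))

  -- A canonical circuit is determined by its start v₀, which lies below the length of its last step,
  -- and its steps, k + 1 of which have length 2 (here n = l + k + 1); a code records v₀, the last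
  -- step and the first m = l − 1 steps.
  data Code : Set where
    endsWith1  : Choice m (suc k) → Code
    endsWith2  : Choice m k → Code
    endsWith2′ : Choice m k → Code

  startOf : Code → ℕ
  startOf (endsWith1 _)  = 0
  startOf (endsWith2 _)  = 0
  startOf (endsWith2′ _) = 1

  firstSteps : Code → Steps
  firstSteps (endsWith1 P)  = toSteps P
  firstSteps (endsWith2 P)  = toSteps P
  firstSteps (endsWith2′ P) = toSteps P

  lastStep : Code → Bool
  lastStep (endsWith1 _)  = false
  lastStep (endsWith2 _)  = true
  lastStep (endsWith2′ _) = true

  closes : ∀ r → distance (firstSteps r) m + stepLength (lastStep r) ≡ n
  closes (endsWith1 P)  = trans (cong (_+ 1) (distance-toSteps P)) (+-comm (m + suc k) 1)
  closes (endsWith2 P)  = trans (cong (_+ 2) (distance-toSteps P)) (trans (+-comm (m + k) 2) (cong suc (sym (+-suc m k))))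
  closes (endsWith2′ P) = trans (cong (_+ 2) (distance-toSteps P)) (trans (+-comm (m + k) 2) (cong suc (sym (+-suc m k))))

  start<lastStep : ∀ r → startOf r < stepLength (lastStep r)
  start<lastStep (endsWith1 _)  = s≤s z≤n
  start<lastStep (endsWith2 _)  = s≤s z≤n
  start<lastStep (endsWith2′ _) = s≤s (s≤s z≤n)

  fits : ∀ r → startOf r + distance (firstSteps r) m < n
  fits r = subst (startOf r + distance (firstSteps r) m <_) (trans (+-comm (stepLength (lastStep r)) _) (closes r))
    (+-monoˡ-< (distance (firstSteps r) m) (start<lastStep r))

  circuitOf : Code → Fin (suc m) → Fin n
  circuitOf r = walkFrom (startOf r) (firstSteps r) (lastStep r) (closes r) (fits r)

  circuitOf-isCircuit : ∀ r → IsCircuit n (suc m) (circuitOf r)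
  circuitOf-isCircuit r = walkFrom-isCircuit (startOf r) (firstSteps r) (lastStep r) (closes r) (fits r)

  circuitOf-canonical : ∀ r → Canonical (circuitOf r)
  circuitOf-canonical r = walkFrom-canonical (startOf r) (firstSteps r) (lastStep r) (closes r) (fits r)

  toℕ-circuitOf : ∀ r i → toℕ (circuitOf r i) ≡ startOf r + distance (firstSteps r) (toℕ i)
  toℕ-circuitOf r = toℕ-walkFrom (startOf r) (firstSteps r) (lastStep r) (closes r) (fits r)

  circuitOf-injective : ∀ r r′ → (∀ i → circuitOf r i ≡ circuitOf r′ i) → r ≡ r′
  circuitOf-injective r r′ same = from-data r r′ start≡ distance≡
    where
    agree : ∀ {u} → u ≤ m → startOf r + distance (firstSteps r) u ≡ startOf r′ + distance (firstSteps r′) u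
    agree {u} u≤m = subst (λ t → startOf r + distance (firstSteps r) t ≡ startOf r′ + distance (firstSteps r′) t)
      (toℕ-fromℕ< (s≤s u≤m))
      (trans (sym (toℕ-circuitOf r i)) (trans (cong toℕ (same i)) (toℕ-circuitOf r′ i)))
      where
      i : Fin (suc m)
      i = fromℕ< (s≤s u≤m)
    start≡ : startOf r ≡ startOf r′
    start≡ = trans (sym (+-identityʳ _)) (trans (agree z≤n) (+-identityʳ _))
    distance≡ : ∀ {u} → u ≤ m → distance (firstSteps r) u ≡ distance (firstSteps r′) u
    distance≡ u≤m = +-cancelˡ-≡ (startOf r) _ _ (trans (agree u≤m) (cong (_+ _) (sym start≡)))
    steps≡ : ∀ {j} (P Q : Choice m j) →
             (∀ {u} → u ≤ m → distance (toSteps P) u ≡ distance (toSteps Q) u) → P ≡ Q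
    steps≡ P Q d≡ = toSteps-injective P Q (λ u u<m → distance-injective (toSteps P) (toSteps Q) m d≡ u<m)
    twos-differ : ∀ (P : Choice m (suc k)) (Q : Choice m k) → distance (toSteps P) m ≢ distance (toSteps Q) m
    twos-differ P Q d≡ =
      <⇒≢ (+-monoʳ-< m (n<1+n k)) (sym (trans (sym (distance-toSteps P)) (trans d≡ (distance-toSteps Q))))
    from-data : ∀ r r′ → startOf r ≡ startOf r′ →
                (∀ {u} → u ≤ m → distance (firstSteps r) u ≡ distance (firstSteps r′) u) → r ≡ r′
    from-data (endsWith1 P)  (endsWith1 Q)  _ d≡ = cong endsWith1 (steps≡ P Q d≡)
    from-data (endsWith2 P)  (endsWith2 Q)  _ d≡ = cong endsWith2 (steps≡ P Q d≡)
    from-data (endsWith2′ P) (endsWith2′ Q) _ d≡ = cong endsWith2′ (steps≡ P Q d≡)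
    from-data (endsWith1 P)  (endsWith2 Q)  _ d≡ = ⊥-elim (twos-differ P Q (d≡ ≤-refl))
    from-data (endsWith2 P)  (endsWith1 Q)  _ d≡ = ⊥-elim (twos-differ Q P (sym (d≡ ≤-refl)))
    from-data (endsWith1 _)  (endsWith2′ _) () _
    from-data (endsWith2 _)  (endsWith2′ _) () _
    from-data (endsWith2′ _) (endsWith1 _)  () _
    from-data (endsWith2′ _) (endsWith2 _)  () _

  windsOnce : ∀ c (circ : IsCircuit n (suc m) c) → distance (stepsOf c circ) (suc m) ≡ n
  windsOnce c circ with winding c circ (<⇒≤ l<n)
  ... | inj₁ once        = once
  ... | inj₂ (l≡n , _)   = ⊥-elim (<⇒≢ l<n l≡n)

  circuitOf-realises : ∀ c (circ : IsCircuit n (suc m) c) → Canonical c →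
                       ∀ r → startOf r ≡ start c circ → (∀ u → u < m → firstSteps r u ≡ stepsOf c circ u) →
                       ∀ i → circuitOf r i ≡ c i
  circuitOf-realises c circ canonical r start≡ steps≡ i = toℕ-injective (begin
    toℕ (circuitOf r i)
      ≡⟨ toℕ-circuitOf r i ⟩
    startOf r + distance (firstSteps r) (toℕ i)
      ≡⟨ cong₂ _+_ start≡ (distance-cong (firstSteps r) (stepsOf c circ) (toℕ i)
                             (λ u u<i → steps≡ u (<-≤-trans u<i (≤-pred (toℕ<n i))))) ⟩
    start c circ + distance (stepsOf c circ) (toℕ i)
      ≡⟨ toℕ-canonical c circ (windsOnce c circ) canonical i ⟨
    toℕ (c i)
      ∎)
    where open ≡-Reasoning

  codeOf : ∀ c (circ : IsCircuit n (suc m) c) → Canonical c → Σ Code λ r → ∀ i → circuitOf r i ≡ c i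
  codeOf c circ canonical = by-last-step (s m) refl
    where
    s : Steps
    s = stepsOf c circ
    start<last : start c circ < stepLength (s m)
    start<last = start<last-step c circ (windsOnce c circ) canonical
    m+w+last≡n : m + twos s m + stepLength (s m) ≡ n
    m+w+last≡n = trans (cong (_+ stepLength (s m)) (sym (distance≡t+twos s m)))
                       (trans (sym (distance-snoc s m)) (windsOnce c circ))
    realises : ∀ r → startOf r ≡ start c circ → (∀ u → u < m → firstSteps r u ≡ s u) → ∀ i → circuitOf r i ≡ c i
    realises = circuitOf-realises c circ canonical
    choice : ∀ {j} → twos s m ≡ j → Choice m j
    choice w≡j = subst (Choice m) w≡j (choiceOf m s)
    choice-steps : ∀ {j} (w≡j : twos s m ≡ j) → ∀ u → u < m → toSteps (choice w≡j) u ≡ s u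
    choice-steps w≡j u u<m =
      trans (cong (λ f → f u) (toSteps-subst w≡j (choiceOf m s))) (toSteps-choiceOf m s u<m)
    by-last-step : ∀ b → s m ≡ b → Σ Code λ r → ∀ i → circuitOf r i ≡ c i
    by-last-step false last≡1 =
      endsWith1 (choice w≡1+k) , realises (endsWith1 (choice w≡1+k)) (sym start≡0) (choice-steps w≡1+k)
      where
      w≡1+k : twos s m ≡ suc k
      w≡1+k = +-cancelˡ-≡ m _ _ (suc-injective (trans (+-comm 1 _)
        (subst (λ b → m + twos s m + stepLength b ≡ n) last≡1 m+w+last≡n)))
      start≡0 : start c circ ≡ 0
      start≡0 = n≤0⇒n≡0 (≤-pred (subst (λ b → start c circ < stepLength b) last≡1 start<last))
    by-last-step true last≡2 =
      by-start (start c circ) refl (subst (λ b → start c circ < stepLength b) last≡2 start<last)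
      where
      w≡k : twos s m ≡ k
      w≡k = +-cancelˡ-≡ m _ _ (suc-injective (suc-injective (trans (+-comm 2 _)
        (trans (subst (λ b → m + twos s m + stepLength b ≡ n) last≡2 m+w+last≡n) (cong suc (+-suc m k))))))
      by-start : ∀ v → start c circ ≡ v → v < 2 → Σ Code λ r → ∀ i → circuitOf r i ≡ c i
      by-start 0 start≡0 _ =
        endsWith2 (choice w≡k) , realises (endsWith2 (choice w≡k)) (sym start≡0) (choice-steps w≡k)
      by-start 1 start≡1 _ =
        endsWith2′ (choice w≡k) , realises (endsWith2′ (choice w≡k)) (sym start≡1) (choice-steps w≡k)
      by-start (2+ _) _ (s≤s (s≤s ()))

  N : ℕ
  N = m C suc k + (m C k + m C k)

  N*l≡n*lC[n∸l] : N * suc m ≡ n * (suc m C (n ∸ suc m))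
  N*l≡n*lC[n∸l] = trans ([mC[1+k]+2*mCk]*[1+m]≡[2+m+k]*[1+m]C[1+k] m k)
    (cong (λ j → (suc m + suc k) * (suc m C j)) (sym (m+n∸m≡n (suc m) (suc k))))

  Code↔Fin : Code ↔ Fin N
  Code↔Fin =
    ↔-trans Code↔Choices
      (↔-trans (Choice↔Fin m (suc k) ⊎-cong (Choice↔Fin m k ⊎-cong Choice↔Fin m k))
        (↔-trans (↔-refl ⊎-cong ↔-sym (+↔⊎ {m C k} {m C k})) (↔-sym (+↔⊎ {m C suc k} {m C k + m C k}))))
    where
    Code↔Choices : Code ↔ (Choice m (suc k) ⊎ (Choice m k ⊎ Choice m k))
    Code↔Choices = mk↔ₛ′ split join split-join join-split
      where
      split : Code → Choice m (suc k) ⊎ (Choice m k ⊎ Choice m k)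
      split (endsWith1 P)  = inj₁ P
      split (endsWith2 P)  = inj₂ (inj₁ P)
      split (endsWith2′ P) = inj₂ (inj₂ P)
      join : Choice m (suc k) ⊎ (Choice m k ⊎ Choice m k) → Code
      join (inj₁ P)        = endsWith1 P
      join (inj₂ (inj₁ P)) = endsWith2 P
      join (inj₂ (inj₂ P)) = endsWith2′ P
      split-join : ∀ x → split (join x) ≡ x
      split-join (inj₁ P)        = refl
      split-join (inj₂ (inj₁ P)) = refl
      split-join (inj₂ (inj₂ P)) = refl
      join-split : ∀ r → join (split r) ≡ r
      join-split (endsWith1 P)  = refl
      join-split (endsWith2 P)  = refl
      join-split (endsWith2′ P) = refl

  rotation-of-circuitOf : ∀ c → IsCircuit n (suc m) c → Σ Code λ r → RotEq n (suc m) (circuitOf r) c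
  rotation-of-circuitOf c circ = proj₁ coded , RotEq-sym (shift , proj₂ coded)
    where
    rotated = rotate-to-canonical c circ
    shift : ℕ
    shift = proj₁ rotated
    coded : Σ Code λ r → ∀ i → circuitOf r i ≡ c (i ⊕ shift)
    coded = codeOf (λ i → c (i ⊕ shift)) (proj₁ (proj₂ rotated)) (proj₂ (proj₂ rotated))

  orbits : NumPrimitiveOrbits n (suc m) N
  orbits = NumPrimitiveOrbits-from (circuitOf ∘ from) isPrimitive distinct complete
    where
    open Inverse Code↔Fin
    circ : ∀ r → IsCircuit n (suc m) (circuitOf r)
    circ = circuitOf-isCircuit
    once : ∀ r → distance (stepsOf (circuitOf r) (circ r)) (suc m) ≡ n
    once r = windsOnce (circuitOf r) (circ r)
    isPrimitive : ∀ j → IsPrimitiveCircuit n (suc m) (circuitOf (from j))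
    isPrimitive j = circ (from j) , ¬IsRepetition (circuitOf (from j)) (circ (from j)) (once (from j))
    distinct : ∀ j j′ → RotEq n (suc m) (circuitOf (from j)) (circuitOf (from j′)) → j ≡ j′
    distinct j j′ rot = begin
      j                ≡⟨ strictlyInverseˡ j ⟨
      to (from j)      ≡⟨ cong to (circuitOf-injective (from j′) (from j)
                            (Canonical-rotation-unique (circuitOf (from j)) (circ (from j)) (once (from j))
                              (circuitOf-canonical (from j)) (circuitOf-canonical (from j′)) rot)) ⟨
      to (from j′)     ≡⟨ strictlyInverseˡ j′ ⟩
      j′               ∎
      where open ≡-Reasoning
    complete : ∀ c → IsPrimitiveCircuit n (suc m) c →
               Σ (Fin N) λ j → RotEq n (suc m) (circuitOf (from j)) c
    complete c (c-circ , _) =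
      to r , subst (λ r′ → RotEq n (suc m) (circuitOf r′) c) (sym (strictlyInverseʳ r)) rot
      where
      r = proj₁ (rotation-of-circuitOf c c-circ)
      rot = proj₂ (rotation-of-circuitOf c c-circ)

module Length≡n (n′ : ℕ) where
  open Circulant n′

  Arithmetic : ℕ → (Fin n → Fin n) → Set
  Arithmetic δ c = ∀ i → toℕ (c i) ≡ (toℕ (c zero) + δ * toℕ i) % n

  Arithmetic-1⊎2 : ∀ c → IsCircuit n n c → Arithmetic 1 c ⊎ Arithmetic 2 c
  Arithmetic-1⊎2 c circ = by-winding (winding c circ ≤-refl)
    where
    s : Steps
    s = stepsOf c circ
    arithmetic : ∀ {δ} → (∀ i → distance s (toℕ i) ≡ δ * toℕ i) → Arithmetic δ c
    arithmetic distance≡ i = trans (toℕ-circuit c circ i) (cong (λ x → (start c circ + x) % n) (distance≡ i))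
    by-winding : distance s n ≡ n ⊎ (n ≡ n × twos s n ≡ n) → Arithmetic 1 c ⊎ Arithmetic 2 c
    by-winding (inj₁ once) =
      inj₁ (arithmetic {1} λ i →
        trans (twos≡0⇒distance≡id s n noTwo (<⇒≤ (toℕ<n i))) (sym (*-identityˡ (toℕ i))))
      where
      noTwo : twos s n ≡ 0
      noTwo = +-cancelˡ-≡ n _ _ (trans (sym (distance≡t+twos s n)) (trans once (sym (+-identityʳ n))))
    by-winding (inj₂ (_ , allTwo)) = inj₂ (arithmetic {2} λ i → twos≡t⇒distance≡2* s n allTwo (<⇒≤ (toℕ<n i)))

  Arithmetic-rotate : ∀ {δ} c d → RotEq n n c d → Arithmetic δ c → Arithmetic δ d
  Arithmetic-rotate {δ} c d (k , d≡c⊕k) c-arith i = begin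
    toℕ (d i)
      ≡⟨ cong toℕ (d≡c⊕k i) ⟩
    toℕ (c (i ⊕ k))
      ≡⟨ c-arith (i ⊕ k) ⟩
    (c₀ + δ * toℕ (i ⊕ k)) % n
      ≡⟨ cong (λ x → (c₀ + δ * x) % n) (toℕ-⊕ i k) ⟩
    (c₀ + δ * ((toℕ i + k) % n)) % n
      ≡⟨ [a+d*[x%l]]%n≡[a+d*x]%n c₀ δ (toℕ i + k) n n (m*n%n≡0 δ n) ⟩
    (c₀ + δ * (toℕ i + k)) % n
      ≡⟨ cong (_% n) (solve 4 (λ c₀ δ i k → c₀ :+ δ :* (i :+ k) := (c₀ :+ δ :* k) :+ δ :* i) refl c₀ δ (toℕ i) k) ⟩
    (c₀ + δ * k + δ * toℕ i) % n
      ≡⟨ [m%n+k]%n≡[m+k]%n (c₀ + δ * k) (δ * toℕ i) n ⟨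
    ((c₀ + δ * k) % n + δ * toℕ i) % n
      ≡⟨ cong (λ x → (x + δ * toℕ i) % n) d₀ ⟨
    (toℕ (d zero) + δ * toℕ i) % n
      ∎
    where
    open ≡-Reasoning
    c₀ = toℕ (c zero)
    d₀ : toℕ (d zero) ≡ (c₀ + δ * k) % n
    d₀ = begin
      toℕ (d zero)                    ≡⟨ cong toℕ (d≡c⊕k zero) ⟩
      toℕ (c (zero ⊕ k))              ≡⟨ c-arith (zero ⊕ k) ⟩
      (c₀ + δ * toℕ (zero ⊕ k)) % n   ≡⟨ cong (λ x → (c₀ + δ * x) % n) (toℕ-⊕ zero k) ⟩
      (c₀ + δ * (k % n)) % n          ≡⟨ [a+d*[x%l]]%n≡[a+d*x]%n c₀ δ k n n (m*n%n≡0 δ n) ⟩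
      (c₀ + δ * k) % n                ∎

  Arithmetic-returns : ∀ {δ c p} → δ ≤ 2 → Arithmetic δ c → p < n → c (zero ⊕ p) ≡ c zero →
                       δ * p ≡ 0 ⊎ δ * p ≡ n ⊎ δ * p ≡ n + n
  Arithmetic-returns {δ} {c} {p} δ≤2 c-arith p<n returns =
    [m+d]%n≡m⇒d≡0⊎n⊎n+n (toℕ (c zero)) (δ * p) n (toℕ<n (c zero)) δp≤2n (begin
      (toℕ (c zero) + δ * p) % n               ≡⟨ cong (λ x → (toℕ (c zero) + δ * x) % n) (toℕ-zero⊕ p<n) ⟨
      (toℕ (c zero) + δ * toℕ (zero ⊕ p)) % n  ≡⟨ c-arith (zero ⊕ p) ⟨
      toℕ (c (zero ⊕ p))                       ≡⟨ cong toℕ returns ⟩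
      toℕ (c zero)                             ∎)
    where
    open ≡-Reasoning
    δp≤2n : δ * p ≤ n + n
    δp≤2n = subst (δ * p ≤_) (cong (n +_) (+-identityʳ n)) (*-mono-≤ δ≤2 (<⇒≤ p<n))

  walk₁ : Fin n → Fin n
  walk₁ = progression 0 1

  walk₂ : Fin n → Fin n
  walk₂ = progression 0 2

  walk₁-isCircuit : IsCircuit n n walk₁
  walk₁-isCircuit = progression-isCircuit 0 false (m*n%n≡0 1 n)

  walk₂-isCircuit : IsCircuit n n walk₂
  walk₂-isCircuit = progression-isCircuit 0 true (m*n%n≡0 2 n)

  walk₁-arithmetic : Arithmetic 1 walk₁
  walk₁-arithmetic i = toℕ-vertex (1 * toℕ i)

  walk₂-arithmetic : Arithmetic 2 walk₂
  walk₂-arithmetic i = toℕ-vertex (2 * toℕ i)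

  rotate-progression : ∀ δ k c → (∀ i → toℕ (c i) ≡ (δ * k + δ * toℕ i) % n) → RotEq n n (progression 0 δ) c
  rotate-progression δ k c c≡ = k , λ i → toℕ-injective (begin
    toℕ (c i)
      ≡⟨ c≡ i ⟩
    (δ * k + δ * toℕ i) % n
      ≡⟨ cong (_% n) (trans (sym (*-distribˡ-+ δ k (toℕ i))) (cong (δ *_) (+-comm k (toℕ i)))) ⟩
    (δ * (toℕ i + k)) % n
      ≡⟨ [a+d*[x%l]]%n≡[a+d*x]%n 0 δ (toℕ i + k) n n (m*n%n≡0 δ n) ⟨
    (δ * ((toℕ i + k) % n)) % n
      ≡⟨ cong (λ x → (δ * x) % n) (toℕ-⊕ i k) ⟨
    (δ * toℕ (i ⊕ k)) % n
      ≡⟨ toℕ-vertex (δ * toℕ (i ⊕ k)) ⟨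
    toℕ (progression 0 δ (i ⊕ k))
      ∎)
    where open ≡-Reasoning

  rotate-walk₁ : ∀ c → Arithmetic 1 c → RotEq n n walk₁ c
  rotate-walk₁ c c-arith = rotate-progression 1 (toℕ (c zero)) c λ i →
    trans (c-arith i) (cong (λ x → (x + 1 * toℕ i) % n) (sym (*-identityˡ (toℕ (c zero)))))

  -- With n = 1 + 2h, the start c₀ is 2 c₀ (1 + h) = c₀ + c₀ n modulo n.
  rotate-walk₂ : ∀ h → n ≡ 1 + h * 2 → ∀ c → Arithmetic 2 c → RotEq n n walk₂ c
  rotate-walk₂ h n≡1+2h c c-arith = rotate-progression 2 (c₀ * (1 + h)) c λ i → begin
    toℕ (c i)
      ≡⟨ c-arith i ⟩
    (c₀ + 2 * toℕ i) % n
      ≡⟨ z%n≡0⇒[y+q*z]%n≡y%n (c₀ + 2 * toℕ i) c₀ n n (n%n≡0 n) ⟨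
    (c₀ + 2 * toℕ i + c₀ * n) % n
      ≡⟨ cong (λ x → (c₀ + 2 * toℕ i + c₀ * x) % n) n≡1+2h ⟩
    (c₀ + 2 * toℕ i + c₀ * (1 + h * 2)) % n
      ≡⟨ cong (_% n) (solve 3 (λ c₀ i h → c₀ :+ con 2 :* i :+ c₀ :* (con 1 :+ h :* con 2)
                                     := con 2 :* (c₀ :* (con 1 :+ h)) :+ con 2 :* i) refl c₀ (toℕ i) h) ⟩
    (2 * (c₀ * (1 + h)) + 2 * toℕ i) % n
      ∎
    where
    open ≡-Reasoning
    c₀ = toℕ (c zero)

  Arithmetic-1×2⇒⊥ : 2 < n → ∀ c → Arithmetic 1 c → Arithmetic 2 c → ⊥
  Arithmetic-1×2⇒⊥ 2<n c arith₁ arith₂ =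
    [m+1]%n≢[m+2]%n (toℕ (c zero)) n 1<n
      (subst (λ t → (toℕ (c zero) + 1 * t) % n ≡ (toℕ (c zero) + 2 * t) % n) toℕ-i₁
        (trans (sym (arith₁ i₁)) (arith₂ i₁)))
    where
    1<n : 1 < n
    1<n = <-trans (s≤s (s≤s z≤n)) 2<n
    i₁ : Fin n
    i₁ = fromℕ< 1<n
    toℕ-i₁ : toℕ i₁ ≡ 1
    toℕ-i₁ = toℕ-fromℕ< 1<n

  walk₁-¬IsRepetition : ¬ IsRepetition n n walk₁
  walk₁-¬IsRepetition rep with IsRepetition⇒returns-early walk₁ rep
  ... | p , 0<p , p<n , returns with Arithmetic-returns (s≤s z≤n) walk₁-arithmetic p<n returns
  ... | inj₁ p≡0         = <⇒≢ 0<p (sym (trans (sym (*-identityˡ p)) p≡0))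
  ... | inj₂ (inj₁ p≡n)  = <⇒≢ p<n (trans (sym (*-identityˡ p)) p≡n)
  ... | inj₂ (inj₂ p≡2n) = <⇒≢ (≤-trans p<n (m≤m+n n n)) (trans (sym (*-identityˡ p)) p≡2n)

  walk₂-¬IsRepetition : n % 2 ≡ 1 → ¬ IsRepetition n n walk₂
  walk₂-¬IsRepetition odd rep with IsRepetition⇒returns-early walk₂ rep
  ... | p , 0<p , p<n , returns with Arithmetic-returns ≤-refl walk₂-arithmetic p<n returns
  ... | inj₁ 2p≡0        = <⇒≢ 0<p (sym (*-cancelˡ-≡ p 0 2 2p≡0))
  ... | inj₂ (inj₁ 2p≡n) = 0≢1+n (trans (sym (trans (cong (_% 2) (trans (sym 2p≡n) (*-comm 2 p))) (m*n%n≡0 p 2))) odd)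
  ... | inj₂ (inj₂ 2p≡2n) = <⇒≢ p<n (*-cancelˡ-≡ p n 2 (trans 2p≡2n (cong (n +_) (sym (+-identityʳ n)))))

  Arithmetic-2⇒IsRepetition : ∀ h → n ≡ 2 * suc h → ∀ c → Arithmetic 2 c → IsRepetition n n c
  Arithmetic-2⇒IsRepetition h n≡2h c c-arith =
    h , h<n , divides 2 n≡2h , half , progression-isCircuit c₀ true winds , c≡half
    where
    c₀ = toℕ (c zero)
    h<n : suc h < n
    h<n = subst (suc h <_) (sym n≡2h) (m<m+n (suc h) (s≤s z≤n))
    half : Fin (suc h) → Fin n
    half = progression c₀ 2
    winds : 2 * suc h % n ≡ 0
    winds = trans (cong (_% n) (sym n≡2h)) (n%n≡0 n)
    c≡half : ∀ i → c i ≡ half (fromℕ< (m%n<n (toℕ i) (suc h)))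
    c≡half i = toℕ-injective (begin
      toℕ (c i)
        ≡⟨ c-arith i ⟩
      (c₀ + 2 * toℕ i) % n
        ≡⟨ [a+d*[x%l]]%n≡[a+d*x]%n c₀ 2 (toℕ i) (suc h) n winds ⟨
      (c₀ + 2 * (toℕ i % suc h)) % n
        ≡⟨ cong (λ x → (c₀ + 2 * x) % n) (toℕ-fromℕ< (m%n<n (toℕ i) (suc h))) ⟨
      (c₀ + 2 * toℕ (fromℕ< (m%n<n (toℕ i) (suc h)))) % n
        ≡⟨ toℕ-vertex (c₀ + 2 * toℕ (fromℕ< (m%n<n (toℕ i) (suc h)))) ⟨
      toℕ (half (fromℕ< (m%n<n (toℕ i) (suc h))))
        ∎)
      where open ≡-Reasoning

  module _ (2<n : 2 < n) where

    odd-orbits : n % 2 ≡ 1 → NumPrimitiveOrbits n n 2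
    odd-orbits odd = NumPrimitiveOrbits-from rep isPrimitive distinct complete
      where
      rep : Fin 2 → Fin n → Fin n
      rep zero       = walk₁
      rep (suc zero) = walk₂
      isPrimitive : ∀ j → IsPrimitiveCircuit n n (rep j)
      isPrimitive zero       = walk₁-isCircuit , walk₁-¬IsRepetition
      isPrimitive (suc zero) = walk₂-isCircuit , walk₂-¬IsRepetition odd
      distinct : ∀ j j′ → RotEq n n (rep j) (rep j′) → j ≡ j′
      distinct zero       zero       _   = refl
      distinct (suc zero) (suc zero) _   = refl
      distinct zero       (suc zero) rot =
        ⊥-elim (Arithmetic-1×2⇒⊥ 2<n walk₂ (Arithmetic-rotate {1} walk₁ walk₂ rot walk₁-arithmetic) walk₂-arithmetic)
      distinct (suc zero) zero       rot =
        ⊥-elim (Arithmetic-1×2⇒⊥ 2<n walk₁ walk₁-arithmetic (Arithmetic-rotate {2} walk₂ walk₁ rot walk₂-arithmetic))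
      n≡1+2h : n ≡ 1 + n / 2 * 2
      n≡1+2h = trans (m≡m%n+[m/n]*n n 2) (cong (_+ n / 2 * 2) odd)
      complete : ∀ c → IsPrimitiveCircuit n n c → Σ (Fin 2) λ j → RotEq n n (rep j) c
      complete c (circ , _) with Arithmetic-1⊎2 c circ
      ... | inj₁ arith₁ = zero , rotate-walk₁ c arith₁
      ... | inj₂ arith₂ = suc zero , rotate-walk₂ (n / 2) n≡1+2h c arith₂

    even-orbits : n % 2 ≡ 0 → NumPrimitiveOrbits n n 1
    even-orbits even =
      NumPrimitiveOrbits-from (λ _ → walk₁) (λ _ → walk₁-isCircuit , walk₁-¬IsRepetition) distinct complete
      where
      distinct : ∀ j j′ → RotEq n n walk₁ walk₁ → j ≡ j′
      distinct zero zero _ = refl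
      n≡2h : n ≡ n / 2 * 2
      n≡2h = trans (m≡m%n+[m/n]*n n 2) (cong (_+ n / 2 * 2) even)
      repeats : ∀ c → Arithmetic 2 c → IsRepetition n n c
      repeats c with n / 2 in half
      ... | zero  = ⊥-elim (1+n≢0 (trans n≡2h (cong (_* 2) half)))
      ... | suc h = Arithmetic-2⇒IsRepetition h (trans n≡2h (trans (cong (_* 2) half) (*-comm (suc h) 2))) c
      complete : ∀ c → IsPrimitiveCircuit n n c → Σ (Fin 1) λ j → RotEq n n walk₁ c
      complete c (circ , ¬rep) with Arithmetic-1⊎2 c circ
      ... | inj₁ arith₁ = zero , rotate-walk₁ c arith₁
      ... | inj₂ arith₂ = ⊥-elim (¬rep (repeats c arith₂))

l<n⇒n≡l+[1+k] : ∀ m n → suc m < n → Σ ℕ λ k → n ≡ suc m + suc k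
l<n⇒n≡l+[1+k] m (suc (suc n)) (s≤s (s≤s m≤n)) =
  n ∸ m , cong suc (sym (trans (+-suc m (n ∸ m)) (cong suc (m+[n∸m]≡n m≤n))))

proposition1 : (n l : ℕ) → 2 < n → 0 < l → l ≤ n →
    (l < n → Σ ℕ λ N → NumPrimitiveOrbits n l N × N * l ≡ n * (l C (n ∸ l))) ×
    (l ≡ n → n % 2 ≡ 1 → NumPrimitiveOrbits n l 2) ×
    (l ≡ n → n % 2 ≡ 0 → NumPrimitiveOrbits n l 1)
proposition1 (suc n′) (suc m) 2<n _ _ =
  shorter , (λ { refl → Length≡n.odd-orbits n′ 2<n }) , (λ { refl → Length≡n.even-orbits n′ 2<n })
  where
  shorter : suc m < suc n′ →
            Σ ℕ λ N → NumPrimitiveOrbits (suc n′) (suc m) N × N * suc m ≡ suc n′ * (suc m C (suc n′ ∸ suc m))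
  shorter l<n with l<n⇒n≡l+[1+k] m (suc n′) l<n
  ... | k , refl = Length<n.N m k , Length<n.orbits m k , Length<n.N*l≡n*lC[n∸l] m k
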